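{- Let $G$ be a connected graph and let $G\overline{G}$ be its complementary prism. Then for every vertex $u \in V(G)$, the set $V(\overline{G})\cup\{u\}$ is a hull set of $G\overline{G}$, i.e. $[V(\overline{G})\cup\{u\}]_{G\overline{G}} = V(G\overline{G})$.
   Context: All graphs are finite, simple and undirected. For a graph $G$ with complement $\overline{G}$, the complementary prism $G\overline{G}$ is the graph obtained from the disjoint union of $G$ and $\overline{G}$ by adding the perfect matching joining each vertex $v$ of $G$ to its copy $\overline{v}$ in $\overline{G}$. For a graph $H$ and $u,v\in V(H)$, $I_H[u,v]$ is the set of vertices lying on some shortest $u,v$-path in $H$. A set $S\subseteq V(H)$ is (geodesically) convex if $I_H[u,v]\subseteq S$ for all $u,v\in S$. The convex hull $[S]_H$ is the smallest convex set of $H$ containing $S$, and $S$ is a hull set if $[S]_H=V(H)$. -}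

module Defs where

open import Data.Nat using (ℕ; zero; suc; _<_)
open import Data.Fin using (Fin; _≟_)
open import Data.Bool using (Bool; true; false; not; _∧_)
open import Data.Unit using (⊤)
open import Data.Sum using (_⊎_; inj₁; inj₂)
open import Data.Product using (Σ; ∃; _×_)
open import Relation.Nullary using (¬_)
open import Relation.Nullary.Decidable using (⌊_⌋)
open import Relation.Binary.PropositionalEquality using (_≡_)

record Graph (n : ℕ) : Set where
  field
    adj    : Fin n → Fin n → Bool
    sym    : ∀ i j → adj i j ≡ adj j i
    irrefl : ∀ i → adj i i ≡ false
open Graph public

compAdj : ∀ {n} → Graph n → Fin n → Fin n → Bool
compAdj G i j = not (adj G i j) ∧ not ⌊ i ≟ j ⌋

-- Vertex set of the complementary prism G Ḡ:
-- inj₁ v is v ∈ V(G), inj₂ v is the copy v̄ ∈ V(Ḡ).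
PrismV : ℕ → Set
PrismV n = Fin n ⊎ Fin n

prismAdj : ∀ {n} → Graph n → PrismV n → PrismV n → Bool
prismAdj G (inj₁ i) (inj₁ j) = adj G i j
prismAdj G (inj₂ i) (inj₂ j) = compAdj G i j
prismAdj G (inj₁ i) (inj₂ j) = ⌊ i ≟ j ⌋
prismAdj G (inj₂ i) (inj₁ j) = ⌊ i ≟ j ⌋

data Walk {V : Set} (A : V → V → Bool) : V → V → ℕ → Set where
  nil  : ∀ u → Walk A u u zero
  cons : ∀ {u w v k} → A u w ≡ true → Walk A w v k → Walk A u v (suc k)

data OnWalk {V : Set} {A : V → V → Bool} (x : V) :
            ∀ {u v k} → Walk A u v k → Set where
  here-nil  : OnWalk x (nil x)
  here-cons : ∀ {w v k} (e : A x w ≡ true) (p : Walk A w v k) → OnWalk x (cons e p)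
  there     : ∀ {u w v k} (e : A u w ≡ true) {p : Walk A w v k} → OnWalk x p → OnWalk x (cons e p)

IsShortest : {V : Set} (A : V → V → Bool) (u v : V) (k : ℕ) → Set
IsShortest A u v k = ∀ m → m < k → ¬ Walk A u v m

Interval : {V : Set} (A : V → V → Bool) (u v x : V) → Set
Interval A u v x =
  Σ ℕ λ k → Σ (Walk A u v k) λ p → IsShortest A u v k × OnWalk x p

Connected : ∀ {n} → Graph n → Set
Connected {n} G = ∀ (u v : Fin n) → ∃ λ k → Walk (adj G) u v k

Convex : {V : Set} (A : V → V → Bool) (S : V → Set) → Set
Convex A S = ∀ u v x → S u → S v → Interval A u v x → S x

-- S is a hull set: its convex hull (the intersection of all convex sets
-- containing S) is the whole vertex set.
IsHullSet : {V : Set} (A : V → V → Bool) (S : V → Set) → Set₁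
IsHullSet {V} A S =
  ∀ (T : V → Set) → Convex A T → (∀ x → S x → T x) → ∀ x → T x

CompPlus : ∀ {n} → Fin n → PrismV n → Set
CompPlus u (inj₁ v) = v ≡ u
CompPlus u (inj₂ v) = ⊤

module Submission where

-- Let T be a convex set of the complementary prism G Ḡ that
-- contains V(Ḡ) ∪ {u}; we must show T is everything.  All of V(Ḡ) is in T
-- by assumption, so it remains to reach every v ∈ V(G).
--
-- The key observation: if w x is an edge of G, then w, x, x̄ is an induced
-- path on three vertices of G Ḡ (w ≠ x, so w is not matched to x̄).  In any
-- graph the middle vertex of an induced P₃ lies on a shortest path between
-- its ends, hence x ∈ I[w, x̄].  So whenever w ∈ T, convexity puts every
-- G-neighbour x of w into T as well.  Following a walk from u to v in the
-- connected graph G then carries membership in T from u to v.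

open import Defs
open import Data.Nat using (zero; suc; s≤s)
open import Data.Fin using (Fin; _≟_)
open import Data.Bool using (Bool; true; false)
open import Data.Sum using (inj₁; inj₂)
open import Data.Product using (_,_; proj₁; proj₂)
open import Relation.Nullary.Decidable using (⌊_⌋; isYes≗does; dec-true; dec-false)
open import Relation.Binary.PropositionalEquality using (_≡_; _≢_; refl; trans) renaming (sym to ≡-sym)

≟-refl : ∀ {n} (i : Fin n) → ⌊ i ≟ i ⌋ ≡ true
≟-refl i = trans (isYes≗does (i ≟ i)) (dec-true (i ≟ i) refl)

≟-distinct : ∀ {n} {i j : Fin n} → i ≢ j → ⌊ i ≟ j ⌋ ≡ false
≟-distinct {i = i} {j} i≢j = trans (isYes≗does (i ≟ j)) (dec-false (i ≟ j) i≢j)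

-- For any adjacency relation, the middle w of an induced path a — w — b
-- (a ≠ b, a and b non-adjacent) lies on a shortest a,b-path: walks of
-- length 0 force a ≡ b and walks of length 1 force an edge ab, so the
-- path a w b of length 2 is shortest.
inducedP₃-middle-in-interval :
  {V : Set} (A : V → V → Bool) {a w b : V} →
  a ≢ b → A a b ≡ false → A a w ≡ true → A w b ≡ true →
  Interval A a b w
inducedP₃-middle-in-interval A {a} {w} {b} a≢b ab≡false aw wb =
  2 , path , shortest , there aw (here-cons wb (nil b))
  where
  path : Walk A a b 2
  path = cons aw (cons wb (nil b))

  shortest : IsShortest A a b 2
  shortest zero       _ (nil _) = a≢b refl
  shortest (suc zero) _ (cons ab≡true (nil _)) with trans (≡-sym ab≡false) ab≡true
  ... | ()
  shortest (suc (suc _)) (s≤s (s≤s ())) _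

module _ {n} (G : Graph n) where

  -- An edge w x of G gives the induced path w — x — x̄ in G Ḡ, so x lies
  -- on a shortest path from w to the copy x̄.
  neighbour-in-interval-to-copy : ∀ {w x} → adj G w x ≡ true →
    Interval (prismAdj G) (inj₁ w) (inj₂ x) (inj₁ x)
  neighbour-in-interval-to-copy {w} {x} wx =
    inducedP₃-middle-in-interval (prismAdj G) (λ ()) (≟-distinct w≢x) wx (≟-refl x)
    where
    w≢x : w ≢ x
    w≢x refl with trans (≡-sym wx) (irrefl G w)
    ... | ()

  convex-closed-under-edges : (T : PrismV n → Set) → Convex (prismAdj G) T →
    (∀ y → T (inj₂ y)) →
    ∀ {w x} → adj G w x ≡ true → T (inj₁ w) → T (inj₁ x)
  convex-closed-under-edges T convex V̄⊆T {w} {x} wx w∈T =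
    convex (inj₁ w) (inj₂ x) (inj₁ x) w∈T (V̄⊆T x)
      (neighbour-in-interval-to-copy wx)

  convex-closed-under-walks : (T : PrismV n → Set) → Convex (prismAdj G) T →
    (∀ y → T (inj₂ y)) →
    ∀ {a b k} → Walk (adj G) a b k → T (inj₁ a) → T (inj₁ b)
  convex-closed-under-walks T convex V̄⊆T (nil _)     a∈T = a∈T
  convex-closed-under-walks T convex V̄⊆T (cons e p) a∈T =
    convex-closed-under-walks T convex V̄⊆T p
      (convex-closed-under-edges T convex V̄⊆T e a∈T)

lemma3p1 : ∀ {n} (G : Graph n) → Connected G → (u : Fin n) →
    IsHullSet (prismAdj G) (CompPlus u)
lemma3p1 G connected u T convex S⊆T (inj₂ y) = S⊆T (inj₂ y) _
lemma3p1 G connected u T convex S⊆T (inj₁ v) =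
  convex-closed-under-walks G T convex V̄⊆T u⇝v (S⊆T (inj₁ u) refl)
  where
  V̄⊆T : ∀ y → T (inj₂ y)
  V̄⊆T y = S⊆T (inj₂ y) _

  u⇝v : Walk (adj G) u v (proj₁ (connected u v))
  u⇝v = proj₂ (connected u v)
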